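{- For all integers $k>1$, $n\ge1$ and $m\ge 0$, $C_k^{(1)}(n,m)=C_k(n-1,m)$.
   Context: A $k$-cycle of a permutation is a cycle of length exactly $k$ in its disjoint cycle decomposition. $C_k(n,m)$ denotes the number of permutations in $S_n$ with exactly $m$ $k$-cycles (with $S_0$ consisting of the single empty permutation), and $C_k^{(a)}(n,m)$ denotes the number of permutations $\pi\in S_n$ with exactly $m$ $k$-cycles and $\pi(1)=a$. -}

module Defs where

open import Data.Nat using (ℕ; zero; suc; _<_; _≤_; _≟_)
open import Data.Fin as Fin using (Fin)
open import Data.Fin.Properties using () renaming (_≟_ to _≟ᶠ_; _≤?_ to _≤?ᶠ_)
open import Data.Vec using (Vec; []; _∷_; lookup)
open import Data.List using (List; []; _∷_; map; concatMap; filter; length; allFin; upTo)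
open import Data.List.Relation.Unary.All using (All; all?)
open import Data.Product using (_×_)
open import Relation.Binary.PropositionalEquality using (_≡_; _≢_)
open import Relation.Nullary using (Dec; ¬?; _→-dec_; _×-dec_)

-- A permutation of {0,…,n-1} (the paper's {1,…,n}, shifted by one) is
-- represented by the vector of its values (one-line notation); π(i) = lookup π i.

allVecs : (n len : ℕ) → List (Vec (Fin n) len)
allVecs n zero = [] ∷ []
allVecs n (suc len) = concatMap (λ x → map (x ∷_) (allVecs n len)) (allFin n)

IsPerm : {n : ℕ} → Vec (Fin n) n → Set
IsPerm {n} π = All (λ i → All (λ j → lookup π i ≡ lookup π j → i ≡ j) (allFin n)) (allFin n)

isPerm? : {n : ℕ} (π : Vec (Fin n) n) → Dec (IsPerm π)
isPerm? {n} π = all? (λ i → all? (λ j → (lookup π i ≟ᶠ lookup π j) →-dec (i ≟ᶠ j)) (allFin n)) (allFin n)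

allPerms : (n : ℕ) → List (Vec (Fin n) n)
allPerms n = filter isPerm? (allVecs n n)

iter : {n : ℕ} → Vec (Fin n) n → ℕ → Fin n → Fin n
iter π zero i = i
iter π (suc t) i = lookup π (iter π t i)

OnKCycle : {n : ℕ} → ℕ → Vec (Fin n) n → Fin n → Set
OnKCycle k π i = (iter π k i ≡ i) × All (λ t → iter π (suc t) i ≢ i) (upTo (k Data.Nat.∸ 1))

onKCycle? : {n : ℕ} (k : ℕ) (π : Vec (Fin n) n) (i : Fin n) → Dec (OnKCycle k π i)
onKCycle? k π i = (iter π k i ≟ᶠ i) ×-dec all? (λ t → ¬? (iter π (suc t) i ≟ᶠ i)) (upTo (k Data.Nat.∸ 1))

CycleLeader : {n : ℕ} → ℕ → Vec (Fin n) n → Fin n → Set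
CycleLeader k π i = OnKCycle k π i × All (λ t → i Fin.≤ iter π t i) (upTo k)

cycleLeader? : {n : ℕ} (k : ℕ) (π : Vec (Fin n) n) (i : Fin n) → Dec (CycleLeader k π i)
cycleLeader? k π i = onKCycle? k π i ×-dec all? (λ t → i ≤?ᶠ iter π t i) (upTo k)

-- Number of k-cycles of π: each k-cycle is counted once, via its least element.
numCycles : {n : ℕ} → ℕ → Vec (Fin n) n → ℕ
numCycles k π = length (filter (cycleLeader? k π) (allFin _))

C : (k n m : ℕ) → ℕ
C k n m = length (filter (λ π → numCycles k π ≟ m) (allPerms n))

-- C_k^{(a)}(n,m) with a given 0-indexed as a : Fin n (paper's a = toℕ a + 1):
-- permutations with exactly m k-cycles and π(first element) = a.
Cat : (k n m : ℕ) → Fin (suc n) → ℕ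
Cat k n m a = length (filter (λ π → (numCycles k π ≟ m) ×-dec (lookup π Fin.zero ≟ᶠ a)) (allPerms (suc n)))

{-# OPTIONS --safe #-}
module Submission where

-- A permutation π of {0,…,n} with π(0) = 0 has 0 as a fixed point, i.e. a 1-cycle;
-- removing it and shifting the remaining values down gives a permutation of
-- {0,…,n-1}, and this is a bijection onto S_n preserving every k-cycle with k > 1.
-- In the one-line encoding the bijection is π = 0 ∷ map suc w, and it is counted by
-- observing that the vectors in allVecs (suc n) len avoiding 0 are exactly the
-- images of allVecs n len under map suc.

open import Defs
open import Data.Nat using (ℕ; zero; suc; _+_; _<_; s≤s; s≤s⁻¹; _≟_) renaming (_≤_ to _≤ℕ_)
open import Data.Nat.Properties using (+-identityʳ)
open import Data.Fin using (Fin; zero; suc; toℕ)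
open import Data.Fin.Properties using (suc-injective; 0≢1+n) renaming (_≟_ to _≟ᶠ_)
open import Data.Vec as Vec using (Vec; []; _∷_; lookup)
open import Data.Vec.Properties using (lookup-map)
open import Data.List as List using (List; []; _∷_; _++_; length; filter; concatMap; allFin)
open import Data.Nat.ListAction using (sum)
open import Data.List.Properties
  using (filter-reject; filter-++; filter-≐; length-++; map-tabulate; map-cong)
open import Data.List.Relation.Unary.All as All using (All; _∷_)
open import Data.List.Relation.Unary.All.Properties using (tabulate⁺; tabulate⁻)
open import Data.Empty using (⊥-elim)
open import Data.Product using (_,_; proj₁; proj₂)
open import Relation.Nullary using (Dec; yes; no; ¬_; _×-dec_)
open import Relation.Binary.PropositionalEquality
  using (_≡_; refl; sym; trans; cong; cong₂; subst; module ≡-Reasoning)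
open ≡-Reasoning

private variable
  A B : Set

count : {P : A → Set} → ((x : A) → Dec (P x)) → List A → ℕ
count P? xs = length (filter P? xs)

count-cong : {P Q : A → Set} (P? : (x : A) → Dec (P x)) (Q? : (x : A) → Dec (Q x)) →
             (∀ x → P x → Q x) → (∀ x → Q x → P x) → (xs : List A) → count P? xs ≡ count Q? xs
count-cong P? Q? P⇒Q Q⇒P xs = cong length (filter-≐ P? Q? ((λ {x} → P⇒Q x) , (λ {x} → Q⇒P x)) xs)

count-++ : {P : A → Set} (P? : (x : A) → Dec (P x)) (xs ys : List A) →
           count P? (xs ++ ys) ≡ count P? xs + count P? ys
count-++ P? xs ys = trans (cong length (filter-++ P? xs ys)) (length-++ (filter P? xs))

count-none : {P : A → Set} (P? : (x : A) → Dec (P x)) → (∀ x → ¬ P x) → (xs : List A) →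
             count P? xs ≡ 0
count-none P? ¬P []       = refl
count-none P? ¬P (x ∷ xs) = trans (cong length (filter-reject P? (¬P x))) (count-none P? ¬P xs)

count-filter : {P Q : A → Set} (P? : (x : A) → Dec (P x)) (Q? : (x : A) → Dec (Q x)) (xs : List A) →
               count P? (filter Q? xs) ≡ count (λ x → Q? x ×-dec P? x) xs
count-filter P? Q? [] = refl
count-filter P? Q? (x ∷ xs) with Q? x
... | no _ = count-filter P? Q? xs
... | yes _ with P? x
...   | yes _ = cong suc (count-filter P? Q? xs)
...   | no _  = count-filter P? Q? xs

count-map : {P : B → Set} (P? : (y : B) → Dec (P y)) (f : A → B) (xs : List A) →
            count P? (List.map f xs) ≡ count (λ x → P? (f x)) xs
count-map P? f [] = refl
count-map P? f (x ∷ xs) with P? (f x)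
... | yes _ = cong suc (count-map P? f xs)
... | no _  = count-map P? f xs

count-concatMap : {P : B → Set} (P? : (y : B) → Dec (P y)) (f : A → List B) (xs : List A) →
                  count P? (concatMap f xs) ≡ sum (List.map (λ x → count P? (f x)) xs)
count-concatMap P? f []       = refl
count-concatMap P? f (x ∷ xs) = trans (count-++ P? (f x) _) (cong (count P? (f x) +_) (count-concatMap P? f xs))

sum-map-zeros : (f : A → ℕ) → (∀ x → f x ≡ 0) → (xs : List A) → sum (List.map f xs) ≡ 0
sum-map-zeros f f≡0 []       = refl
sum-map-zeros f f≡0 (x ∷ xs) = cong₂ _+_ (f≡0 x) (sum-map-zeros f f≡0 xs)

allFin-suc : (n : ℕ) → allFin (suc n) ≡ zero ∷ List.map suc (allFin n)
allFin-suc n = cong (zero ∷_) (sym (map-tabulate (λ i → i) suc))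

sum-allFin-suc : {n : ℕ} (f : Fin (suc n) → ℕ) →
                 sum (List.map f (allFin (suc n))) ≡ f zero + sum (List.map (λ i → f (suc i)) (allFin n))
sum-allFin-suc f =
  cong (λ xs → f zero + sum xs) (trans (map-tabulate suc f) (sym (map-tabulate (λ i → i) (λ i → f (suc i)))))

count-allVecs-suc : {n len : ℕ} {P : Vec (Fin n) (suc len) → Set} (P? : ∀ v → Dec (P v)) →
                    count P? (allVecs n (suc len))
                      ≡ sum (List.map (λ x → count (λ v → P? (x ∷ v)) (allVecs n len)) (allFin n))
count-allVecs-suc {n} {len} P? = begin
  count P? (allVecs n (suc len))
    ≡⟨ count-concatMap P? _ (allFin n) ⟩
  sum (List.map (λ x → count P? (List.map (x ∷_) (allVecs n len))) (allFin n))
    ≡⟨ cong sum (map-cong (λ x → count-map P? (x ∷_) (allVecs n len)) (allFin n)) ⟩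
  sum (List.map (λ x → count (λ v → P? (x ∷ v)) (allVecs n len)) (allFin n)) ∎

count-allVecs-headZero : {n len : ℕ} {P : Vec (Fin (suc n)) (suc len) → Set} (P? : ∀ v → Dec (P v)) →
                         (∀ x v → P (x ∷ v) → x ≡ zero) →
                         count P? (allVecs (suc n) (suc len)) ≡ count (λ v → P? (zero ∷ v)) (allVecs (suc n) len)
count-allVecs-headZero {n} {len} P? head≡0 = begin
  count P? (allVecs (suc n) (suc len))
    ≡⟨ count-allVecs-suc P? ⟩
  sum (List.map countFrom (allFin (suc n)))
    ≡⟨ sum-allFin-suc countFrom ⟩
  countFrom zero + sum (List.map (λ i → countFrom (suc i)) (allFin n))
    ≡⟨ cong (countFrom zero +_) (sum-map-zeros _ countFrom-suc≡0 (allFin n)) ⟩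
  countFrom zero + 0
    ≡⟨ +-identityʳ _ ⟩
  countFrom zero ∎
  where
  countFrom : Fin (suc n) → ℕ
  countFrom x = count (λ v → P? (x ∷ v)) (allVecs (suc n) len)

  countFrom-suc≡0 : ∀ i → countFrom (suc i) ≡ 0
  countFrom-suc≡0 i = count-none _ (λ v p → 0≢1+n (sym (head≡0 (suc i) v p))) (allVecs (suc n) len)

count-allVecs-avoidingZero : {n : ℕ} (len : ℕ) {R : Vec (Fin (suc n)) len → Set} (R? : ∀ v → Dec (R v)) →
                             (∀ v i → lookup v i ≡ zero → ¬ R v) →
                             count R? (allVecs (suc n) len) ≡ count (λ w → R? (Vec.map suc w)) (allVecs n len)
count-allVecs-avoidingZero zero R? avoids with R? []
... | yes _ = refl
... | no _  = refl
count-allVecs-avoidingZero {n} (suc len) R? avoids = begin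
  count R? (allVecs (suc n) (suc len))
    ≡⟨ count-allVecs-suc R? ⟩
  sum (List.map countFrom (allFin (suc n)))
    ≡⟨ sum-allFin-suc countFrom ⟩
  countFrom zero + sum (List.map (λ i → countFrom (suc i)) (allFin n))
    ≡⟨ cong₂ _+_ countFrom-zero≡0 (cong sum (map-cong countFrom-suc (allFin n))) ⟩
  sum (List.map (λ i → count (λ w → R? (Vec.map suc (i ∷ w))) (allVecs n len)) (allFin n))
    ≡⟨ sym (count-allVecs-suc (λ w → R? (Vec.map suc w))) ⟩
  count (λ w → R? (Vec.map suc w)) (allVecs n (suc len)) ∎
  where
  countFrom : Fin (suc n) → ℕ
  countFrom x = count (λ v → R? (x ∷ v)) (allVecs (suc n) len)

  countFrom-zero≡0 : countFrom zero ≡ 0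
  countFrom-zero≡0 = count-none _ (λ v → avoids (zero ∷ v) zero refl) (allVecs (suc n) len)

  countFrom-suc : ∀ i → countFrom (suc i) ≡ count (λ w → R? (suc i ∷ Vec.map suc w)) (allVecs n len)
  countFrom-suc i = count-allVecs-avoidingZero len (λ v → R? (suc i ∷ v)) (λ v j → avoids (suc i ∷ v) (suc j))

fixZero : {n : ℕ} → Vec (Fin n) n → Vec (Fin (suc n)) (suc n)
fixZero w = zero ∷ Vec.map suc w

module _ {n : ℕ} (π : Vec (Fin n) n) where

  isPerm⁺ : (∀ i j → lookup π i ≡ lookup π j → i ≡ j) → IsPerm π
  isPerm⁺ inj = tabulate⁺ λ i → tabulate⁺ (inj i)

  isPerm⁻ : IsPerm π → ∀ i j → lookup π i ≡ lookup π j → i ≡ j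
  isPerm⁻ p i j = tabulate⁻ (tabulate⁻ p i) j

module _ {n : ℕ} (w : Vec (Fin n) n) where

  isPerm-fixZero⁻ : IsPerm (fixZero w) → IsPerm w
  isPerm-fixZero⁻ p = isPerm⁺ w λ i j wi≡wj → suc-injective (isPerm⁻ (fixZero w) p (suc i) (suc j)
    (trans (lookup-map i suc w) (trans (cong suc wi≡wj) (sym (lookup-map j suc w)))))

  isPerm-fixZero : IsPerm w → IsPerm (fixZero w)
  isPerm-fixZero p = isPerm⁺ (fixZero w) injective
    where
    injective : ∀ i j → lookup (fixZero w) i ≡ lookup (fixZero w) j → i ≡ j
    injective zero    zero    _  = refl
    injective zero    (suc j) eq = ⊥-elim (0≢1+n (trans eq (lookup-map j suc w)))
    injective (suc i) zero    eq = ⊥-elim (0≢1+n (trans (sym eq) (lookup-map i suc w)))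
    injective (suc i) (suc j) eq = cong suc (isPerm⁻ w p i j
      (suc-injective (trans (sym (lookup-map i suc w)) (trans eq (lookup-map j suc w)))))

¬isPerm-zero∷ : {n : ℕ} (v : Vec (Fin (suc n)) n) (i : Fin n) → lookup v i ≡ zero → ¬ IsPerm (zero ∷ v)
¬isPerm-zero∷ v i vi≡0 p with isPerm⁻ (zero ∷ v) p zero (suc i) (sym vi≡0)
... | ()

count-fixingZero : {n : ℕ} {Q : Vec (Fin (suc n)) (suc n) → Set} (Q? : ∀ π → Dec (Q π)) →
                   count (λ π → Q? π ×-dec (lookup π zero ≟ᶠ zero)) (allPerms (suc n))
                     ≡ count (λ w → Q? (fixZero w)) (allPerms n)
count-fixingZero {n} Q? = begin
  count (λ π → Q? π ×-dec (lookup π zero ≟ᶠ zero)) (allPerms (suc n))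
    ≡⟨ count-filter _ isPerm? (allVecs (suc n) (suc n)) ⟩
  count (λ π → isPerm? π ×-dec (Q? π ×-dec (lookup π zero ≟ᶠ zero))) (allVecs (suc n) (suc n))
    ≡⟨ count-allVecs-headZero (λ π → isPerm? π ×-dec (Q? π ×-dec (lookup π zero ≟ᶠ zero))) (λ x v p → proj₂ (proj₂ p)) ⟩
  count (λ v → isPerm? (zero ∷ v) ×-dec (Q? (zero ∷ v) ×-dec (zero ≟ᶠ zero))) (allVecs (suc n) n)
    ≡⟨ count-allVecs-avoidingZero n _ (λ v i vi≡0 p → ¬isPerm-zero∷ v i vi≡0 (proj₁ p)) ⟩
  count (λ w → isPerm? (fixZero w) ×-dec (Q? (fixZero w) ×-dec (zero ≟ᶠ zero))) (allVecs n n)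
    ≡⟨ count-cong _ _ (λ w (p , q , _) → isPerm-fixZero⁻ w p , q)
                      (λ w (p , q) → isPerm-fixZero w p , q , refl) (allVecs n n) ⟩
  count (λ w → isPerm? w ×-dec Q? (fixZero w)) (allVecs n n)
    ≡⟨ count-filter _ isPerm? (allVecs n n) ⟨
  count (λ w → Q? (fixZero w)) (allPerms n) ∎

module _ {n : ℕ} (w : Vec (Fin n) n) where

  iter-fixZero : ∀ t i → iter (fixZero w) t (suc i) ≡ suc (iter w t i)
  iter-fixZero zero    i = refl
  iter-fixZero (suc t) i = trans (cong (lookup (fixZero w)) (iter-fixZero t i)) (lookup-map (iter w t i) suc w)

  cycleLeader-fixZero⁻ : ∀ k i → CycleLeader k (fixZero w) (suc i) → CycleLeader k w i
  cycleLeader-fixZero⁻ k i ((returns , noEarlyReturn) , least) =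
    ( suc-injective (trans (sym (iter-fixZero k i)) returns)
    , All.map (λ {t} ≢i ≡i → ≢i (trans (iter-fixZero (suc t) i) (cong suc ≡i))) noEarlyReturn )
    , All.map (λ {t} ≤ → s≤s⁻¹ (subst (λ j → toℕ (suc i) ≤ℕ toℕ j) (iter-fixZero t i) ≤)) least

  cycleLeader-fixZero : ∀ k i → CycleLeader k w i → CycleLeader k (fixZero w) (suc i)
  cycleLeader-fixZero k i ((returns , noEarlyReturn) , least) =
    ( trans (iter-fixZero k i) (cong suc returns)
    , All.map (λ {t} ≢i ≡i → ≢i (suc-injective (trans (sym (iter-fixZero (suc t) i)) ≡i))) noEarlyReturn )
    , All.map (λ {t} ≤ → subst (λ j → toℕ (suc i) ≤ℕ toℕ j) (sym (iter-fixZero t i)) (s≤s ≤)) least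

  ¬cycleLeader-fixZero-zero : ∀ {k} → 1 < k → ¬ CycleLeader k (fixZero w) zero
  ¬cycleLeader-fixZero-zero {suc zero}    (s≤s ())
  ¬cycleLeader-fixZero-zero {suc (suc _)} _ ((_ , fixedTooEarly ∷ _) , _) = fixedTooEarly refl

  numCycles-fixZero : ∀ k → 1 < k → numCycles k (fixZero w) ≡ numCycles k w
  numCycles-fixZero k 1<k = begin
    count (cycleLeader? k (fixZero w)) (allFin (suc n))
      ≡⟨ cong (count (cycleLeader? k (fixZero w))) (allFin-suc n) ⟩
    count (cycleLeader? k (fixZero w)) (zero ∷ List.map suc (allFin n))
      ≡⟨ cong length (filter-reject (cycleLeader? k (fixZero w)) (¬cycleLeader-fixZero-zero 1<k)) ⟩
    count (cycleLeader? k (fixZero w)) (List.map suc (allFin n))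
      ≡⟨ count-map (cycleLeader? k (fixZero w)) suc (allFin n) ⟩
    count (λ i → cycleLeader? k (fixZero w) (suc i)) (allFin n)
      ≡⟨ count-cong _ (cycleLeader? k w) (cycleLeader-fixZero⁻ k) (cycleLeader-fixZero k) (allFin n) ⟩
    count (cycleLeader? k w) (allFin n) ∎

proposition2p4 : (k n m : ℕ) → 1 < k → Cat k n m zero ≡ C k n m
proposition2p4 k n m 1<k = begin
  Cat k n m zero
    ≡⟨ count-fixingZero {n} (λ π → numCycles k π ≟ m) ⟩
  count (λ w → numCycles k (fixZero w) ≟ m) (allPerms n)
    ≡⟨ count-cong _ _ (λ w → trans (sym (numCycles-fixZero w k 1<k)))
                      (λ w → trans (numCycles-fixZero w k 1<k)) (allPerms n) ⟩
  C k n m ∎
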